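{- The variety $\mathcal V$ of lattice skew Hilbert algebras is arithmetical (i.e. congruence permutable and congruence distributive) and weakly regular (i.e. for every $\mathbf L\in\mathcal V$ and all congruences $\Theta,\Phi$ of $\mathbf L$, $[1]\Theta=[1]\Phi$ implies $\Theta=\Phi$).
   Context: $\mathcal V$ is the variety of algebras $(L,\lor,\land,*,1)$ of type $(2,2,2,0)$ such that $(L,\lor,\land)$ is a lattice and the identities (L1) $x*(x\lor y)\approx1$, (L2) $x*((x*y)*y)\approx1$, (L3) $((x\lor y)*z)*(x*z)\approx1$, (L4) $(x\lor y)\land(x*y)\approx y$ hold. -}

module Defs where

open import Level using (Level; _⊔_; suc; Setω)
open import Relation.Binary.PropositionalEquality using (_≡_)
open import Relation.Binary.Core using (Rel)
open import Relation.Binary.Structures using (IsEquivalence)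
open import Algebra.Lattice.Structures using (IsLattice)
open import Data.Product using (_×_; ∃; _,_)
open import Data.Sum using (_⊎_)

record LSHA (a : Level) : Set (suc a) where
  infixr 5 _*_
  infixr 6 _∨_
  infixr 7 _∧_
  field
    Carrier : Set a
    _∨_ _∧_ _*_ : Carrier → Carrier → Carrier
    𝟏 : Carrier
    isLattice : IsLattice _≡_ _∨_ _∧_
    L1 : ∀ x y → x * (x ∨ y) ≡ 𝟏
    L2 : ∀ x y → x * ((x * y) * y) ≡ 𝟏
    L3 : ∀ x y z → ((x ∨ y) * z) * (x * z) ≡ 𝟏
    L4 : ∀ x y → (x ∨ y) ∧ (x * y) ≡ y

record Congruence {a : Level} (L : LSHA a) (ℓ : Level) : Set (a ⊔ suc ℓ) where
  open LSHA L
  field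
    R : Rel Carrier ℓ
    isEquivalence : IsEquivalence R
    ∨-cong : ∀ {x y u v} → R x y → R u v → R (x ∨ u) (y ∨ v)
    ∧-cong : ∀ {x y u v} → R x y → R u v → R (x ∧ u) (y ∧ v)
    *-cong : ∀ {x y u v} → R x y → R u v → R (x * u) (y * v)

_⊆ᵣ_ : ∀ {a ℓ₁ ℓ₂} {A : Set a} → Rel A ℓ₁ → Rel A ℓ₂ → Set (a ⊔ ℓ₁ ⊔ ℓ₂)
P ⊆ᵣ Q = ∀ {x y} → P x y → Q x y

_≐ᵣ_ : ∀ {a ℓ₁ ℓ₂} {A : Set a} → Rel A ℓ₁ → Rel A ℓ₂ → Set (a ⊔ ℓ₁ ⊔ ℓ₂)
P ≐ᵣ Q = (P ⊆ᵣ Q) × (Q ⊆ᵣ P)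

_∘ᵣ_ : ∀ {a ℓ₁ ℓ₂} {A : Set a} → Rel A ℓ₁ → Rel A ℓ₂ → Rel A (a ⊔ ℓ₁ ⊔ ℓ₂)
(P ∘ᵣ Q) x y = ∃ λ z → P x z × Q z y

_∩ᵣ_ : ∀ {a ℓ₁ ℓ₂} {A : Set a} → Rel A ℓ₁ → Rel A ℓ₂ → Rel A (ℓ₁ ⊔ ℓ₂)
(P ∩ᵣ Q) x y = P x y × Q x y

-- Transitive closure of the union (the join in the congruence lattice).
data JoinRel {a ℓ₁ ℓ₂} {A : Set a} (P : Rel A ℓ₁) (Q : Rel A ℓ₂)
     : A → A → Set (a ⊔ ℓ₁ ⊔ ℓ₂) where
  step : ∀ {x y} → P x y ⊎ Q x y → JoinRel P Q x y
  trans : ∀ {x y z} → JoinRel P Q x y → JoinRel P Q y z → JoinRel P Q x z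

module _ {a ℓ : Level} {L : LSHA a} where
  open Congruence

  Permute : Congruence L ℓ → Congruence L ℓ → Set (a ⊔ ℓ)
  Permute Θ Φ = (R Θ ∘ᵣ R Φ) ≐ᵣ (R Φ ∘ᵣ R Θ)

  Distrib : Congruence L ℓ → Congruence L ℓ → Congruence L ℓ → Set (a ⊔ ℓ)
  Distrib Θ Φ Ψ =
    (R Θ ∩ᵣ JoinRel (R Φ) (R Ψ)) ≐ᵣ JoinRel (R Θ ∩ᵣ R Φ) (R Θ ∩ᵣ R Ψ)

CongruencePermutable : Setω
CongruencePermutable = ∀ {a ℓ} (L : LSHA a) (Θ Φ : Congruence L ℓ) → Permute Θ Φ

CongruenceDistributive : Setω
CongruenceDistributive =
  ∀ {a ℓ} (L : LSHA a) (Θ Φ Ψ : Congruence L ℓ) → Distrib Θ Φ Ψ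

record Arithmetical : Setω where
  field
    permutable : CongruencePermutable
    distributive : CongruenceDistributive

WeaklyRegular : Setω
WeaklyRegular =
  ∀ {a ℓ} (L : LSHA a) (Θ Φ : Congruence L ℓ) →
  (∀ x → (Congruence.R Θ x (LSHA.𝟏 L) → Congruence.R Φ x (LSHA.𝟏 L))
       × (Congruence.R Φ x (LSHA.𝟏 L) → Congruence.R Θ x (LSHA.𝟏 L))) →
  Congruence.R Θ ≐ᵣ Congruence.R Φ

record ArithmeticalAndWeaklyRegular : Setω where
  field
    arithmetical : Arithmetical
    weaklyRegular : WeaklyRegular

-- The term p(x,y,z) = ((x * y) * z) ∧ ((z * y) * x) is a Mal'cev term for 𝒱, so
-- congruences permute, and the lattice majority term then makes the congruence
-- lattice distributive. For weak regularity: x * y = 1 means x ≤ y, so by (L4)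
-- x Θ y holds exactly when x * y and y * x lie in the class [1]Θ.
module Submission where

open import Defs renaming (trans to join-trans)
open import Level using (Level; _⊔_)
open import Function using (_∘_)
open import Relation.Binary.Core using (Rel)
open import Relation.Binary.Definitions using (Reflexive; Symmetric; Transitive)
open import Relation.Binary.Structures using (IsEquivalence)
open import Relation.Binary.PropositionalEquality
  using (_≡_; refl; sym; cong; cong₂; subst; module ≡-Reasoning)
open import Algebra.Lattice.Bundles using (Lattice)
open import Data.Product using (_,_; proj₁; proj₂)
open import Data.Sum using (inj₁; inj₂)

module _ {a : Level} {A : Set a} where

  Compatible₃ : ∀ {ℓ} → Rel A ℓ → (A → A → A → A) → Set (a ⊔ ℓ)
  Compatible₃ R f =
    ∀ {x x′ y y′ z z′} → R x x′ → R y y′ → R z z′ → R (f x y z) (f x′ y′ z′)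

  module _ {ℓ₁ ℓ₂ : Level} (R : Rel A ℓ₁) (S : Rel A ℓ₂) where

    malcev⇒∘ᵣ-comm : (p : A → A → A → A) →
                     (∀ x z → p x x z ≡ z) → (∀ x z → p x z z ≡ x) →
                     Reflexive R → Reflexive S → Symmetric S →
                     Compatible₃ R p → Compatible₃ S p →
                     (R ∘ᵣ S) ⊆ᵣ (S ∘ᵣ R)
    malcev⇒∘ᵣ-comm p p-xxz p-xzz R-refl S-refl S-sym R-p S-p {x} {y} (z , xRz , zSy) =
      p x z y ,
      subst (λ u → S u (p x z y)) (p-xzz x y) (S-p S-refl (S-sym zSy) S-refl) ,
      subst (R (p x z y)) (p-xxz z y) (R-p xRz R-refl R-refl)

    ∘ᵣ⊆JoinRel : (R ∘ᵣ S) ⊆ᵣ JoinRel R S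
    ∘ᵣ⊆JoinRel (_ , xRz , zSy) = join-trans (step (inj₁ xRz)) (step (inj₂ zSy))

    ∘ᵣ-comm⇒JoinRel⊆∘ᵣ : Reflexive R → Reflexive S → Transitive R → Transitive S →
                         (S ∘ᵣ R) ⊆ᵣ (R ∘ᵣ S) → JoinRel R S ⊆ᵣ (R ∘ᵣ S)
    ∘ᵣ-comm⇒JoinRel⊆∘ᵣ R-refl S-refl R-trans S-trans comm = go
      where
        go : JoinRel R S ⊆ᵣ (R ∘ᵣ S)
        go {y = y} (step (inj₁ xRy)) = y , xRy , S-refl
        go {x = x} (step (inj₂ xSy)) = x , R-refl , xSy
        go (join-trans j k) with go j | go k
        ... | _ , xRu , uSv | _ , vRw , wSy with comm (_ , uSv , vRw)
        ...   | _ , uRt , tSw = _ , R-trans xRu uRt , S-trans tSw wSy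

  module _ {ℓ₁ ℓ₂ ℓ₃ : Level} (Θ : Rel A ℓ₁) (Φ : Rel A ℓ₂) (Ψ : Rel A ℓ₃) where

    majority⇒∩-∘ᵣ-distrib : (m : A → A → A → A) →
                            (∀ x y → m x x y ≡ x) → (∀ x y → m x y x ≡ x) →
                            (∀ x y → m y x x ≡ x) →
                            Reflexive Θ → Reflexive Φ → Reflexive Ψ →
                            Compatible₃ Θ m → Compatible₃ Φ m → Compatible₃ Ψ m →
                            (Θ ∩ᵣ (Φ ∘ᵣ Ψ)) ⊆ᵣ ((Θ ∩ᵣ Φ) ∘ᵣ (Θ ∩ᵣ Ψ))
    majority⇒∩-∘ᵣ-distrib m m-xxy m-xyx m-yxx Θ-refl Φ-refl Ψ-refl Θ-m Φ-m Ψ-m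
                          {x} {y} (xΘy , z , xΦz , zΨy) =
      m x z y ,
      ( subst (λ u → Θ u (m x z y)) (m-xyx x z) (Θ-m Θ-refl Θ-refl xΘy)
      , subst (λ u → Φ u (m x z y)) (m-xxy x y) (Φ-m Φ-refl xΦz Φ-refl) ) ,
      ( subst (Θ (m x z y)) (m-xyx y z) (Θ-m xΘy Θ-refl Θ-refl)
      , subst (Ψ (m x z y)) (m-yxx y x) (Ψ-m Ψ-refl zΨy Ψ-refl) )

    JoinRel-∩ᵣ : Transitive Θ → JoinRel (Θ ∩ᵣ Φ) (Θ ∩ᵣ Ψ) ⊆ᵣ (Θ ∩ᵣ JoinRel Φ Ψ)
    JoinRel-∩ᵣ Θ-trans (step (inj₁ (xΘy , xΦy))) = xΘy , step (inj₁ xΦy)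
    JoinRel-∩ᵣ Θ-trans (step (inj₂ (xΘy , xΨy))) = xΘy , step (inj₂ xΨy)
    JoinRel-∩ᵣ Θ-trans (join-trans j k) with JoinRel-∩ᵣ Θ-trans j | JoinRel-∩ᵣ Θ-trans k
    ... | xΘu , xJu | uΘy , uJy = Θ-trans xΘu uΘy , join-trans xJu uJy

module MajorityTerm {c ℓ : Level} (𝓛 : Lattice c ℓ) where
  open Lattice 𝓛
  open import Algebra.Lattice.Properties.Lattice 𝓛 using (∧-idem; ∨-idem)
  open import Relation.Binary.Reasoning.Setoid setoid

  majority : Carrier → Carrier → Carrier → Carrier
  majority x y z = x ∧ y ∨ y ∧ z ∨ z ∧ x

  x∧y∨x≈x : ∀ x y → x ∧ y ∨ x ≈ x
  x∧y∨x≈x x y = trans (∨-comm (x ∧ y) x) (∨-absorbs-∧ x y)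

  majority-xxy : ∀ x y → majority x x y ≈ x
  majority-xxy x y = begin
    x ∧ x ∨ x ∧ y ∨ y ∧ x ≈⟨ ∨-cong (∧-idem x) (∨-congˡ (∧-comm y x)) ⟩
    x ∨ x ∧ y ∨ x ∧ y     ≈⟨ ∨-congˡ (∨-idem (x ∧ y)) ⟩
    x ∨ x ∧ y             ≈⟨ ∨-absorbs-∧ x y ⟩
    x                     ∎

  majority-xyx : ∀ x y → majority x y x ≈ x
  majority-xyx x y = begin
    x ∧ y ∨ y ∧ x ∨ x ∧ x ≈⟨ ∨-congˡ (∨-cong (∧-comm y x) (∧-idem x)) ⟩
    x ∧ y ∨ x ∧ y ∨ x     ≈⟨ ∨-congˡ (x∧y∨x≈x x y) ⟩
    x ∧ y ∨ x             ≈⟨ x∧y∨x≈x x y ⟩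
    x                     ∎

  majority-yxx : ∀ x y → majority y x x ≈ x
  majority-yxx x y = begin
    y ∧ x ∨ x ∧ x ∨ x ∧ y ≈⟨ ∨-cong (∧-comm y x) (∨-congʳ (∧-idem x)) ⟩
    x ∧ y ∨ x ∨ x ∧ y     ≈⟨ ∨-congˡ (∨-absorbs-∧ x y) ⟩
    x ∧ y ∨ x             ≈⟨ x∧y∨x≈x x y ⟩
    x                     ∎

module Properties {a : Level} (L : LSHA a) where
  open LSHA L

  lattice : Lattice a a
  lattice = record { isLattice = isLattice }

  open Lattice lattice using (∨-absorbs-∧; ∧-absorbs-∨; ∨-comm; ∧-comm)
  open import Algebra.Lattice.Properties.Lattice lattice using (∨-idem)
  open MajorityTerm lattice public
  open ≡-Reasoning

  *-refl : ∀ x → x * x ≡ 𝟏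
  *-refl x = begin
    x * x       ≡⟨ cong (x *_) (sym (∨-idem x)) ⟩
    x * (x ∨ x) ≡⟨ L1 x x ⟩
    𝟏           ∎

  ∧-identityʳ : ∀ x → x ∧ 𝟏 ≡ x
  ∧-identityʳ x = begin
    x ∧ 𝟏             ≡⟨ cong₂ _∧_ (sym (∨-idem x)) (sym (*-refl x)) ⟩
    (x ∨ x) ∧ (x * x) ≡⟨ L4 x x ⟩
    x                 ∎

  ∧-identityˡ : ∀ x → 𝟏 ∧ x ≡ x
  ∧-identityˡ x = begin
    𝟏 ∧ x ≡⟨ ∧-comm 𝟏 x ⟩
    x ∧ 𝟏 ≡⟨ ∧-identityʳ x ⟩
    x     ∎

  ∨-zeroˡ : ∀ x → 𝟏 ∨ x ≡ 𝟏
  ∨-zeroˡ x = begin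
    𝟏 ∨ x       ≡⟨ cong (𝟏 ∨_) (sym (∧-identityˡ x)) ⟩
    𝟏 ∨ 𝟏 ∧ x   ≡⟨ ∨-absorbs-∧ 𝟏 x ⟩
    𝟏           ∎

  *-identityˡ : ∀ x → 𝟏 * x ≡ x
  *-identityˡ x = begin
    𝟏 * x             ≡⟨ sym (∧-identityˡ (𝟏 * x)) ⟩
    𝟏 ∧ (𝟏 * x)       ≡⟨ cong (_∧ (𝟏 * x)) (sym (∨-zeroˡ x)) ⟩
    (𝟏 ∨ x) ∧ (𝟏 * x) ≡⟨ L4 𝟏 x ⟩
    x                 ∎

  x*y≡𝟏⇒x∨y≡y : ∀ {x y} → x * y ≡ 𝟏 → x ∨ y ≡ y
  x*y≡𝟏⇒x∨y≡y {x} {y} x*y≡𝟏 = begin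
    x ∨ y             ≡⟨ sym (∧-identityʳ (x ∨ y)) ⟩
    (x ∨ y) ∧ 𝟏       ≡⟨ cong ((x ∨ y) ∧_) (sym x*y≡𝟏) ⟩
    (x ∨ y) ∧ (x * y) ≡⟨ L4 x y ⟩
    y                 ∎

  x*y≡𝟏⇒x∧y≡x : ∀ {x y} → x * y ≡ 𝟏 → x ∧ y ≡ x
  x*y≡𝟏⇒x∧y≡x {x} {y} x*y≡𝟏 = begin
    x ∧ y       ≡⟨ cong (x ∧_) (sym (x*y≡𝟏⇒x∨y≡y x*y≡𝟏)) ⟩
    x ∧ (x ∨ y) ≡⟨ ∧-absorbs-∨ x y ⟩
    x           ∎

  malcev : Carrier → Carrier → Carrier → Carrier
  malcev x y z = ((x * y) * z) ∧ ((z * y) * x)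

  malcev-xxz : ∀ x z → malcev x x z ≡ z
  malcev-xxz x z = begin
    ((x * x) * z) ∧ ((z * x) * x) ≡⟨ cong (λ u → (u * z) ∧ ((z * x) * x)) (*-refl x) ⟩
    (𝟏 * z) ∧ ((z * x) * x)       ≡⟨ cong (_∧ ((z * x) * x)) (*-identityˡ z) ⟩
    z ∧ ((z * x) * x)             ≡⟨ x*y≡𝟏⇒x∧y≡x (L2 z x) ⟩
    z                             ∎

  malcev-xzz : ∀ x z → malcev x z z ≡ x
  malcev-xzz x z = begin
    ((x * z) * z) ∧ ((z * z) * x) ≡⟨ cong (λ u → ((x * z) * z) ∧ (u * x)) (*-refl z) ⟩
    ((x * z) * z) ∧ (𝟏 * x)       ≡⟨ cong (((x * z) * z) ∧_) (*-identityˡ x) ⟩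
    ((x * z) * z) ∧ x             ≡⟨ ∧-comm ((x * z) * z) x ⟩
    x ∧ ((x * z) * z)             ≡⟨ x*y≡𝟏⇒x∧y≡x (L2 x z) ⟩
    x                             ∎

  module _ {ℓ : Level} (Θ : Congruence L ℓ) where
    open Congruence Θ
    open IsEquivalence isEquivalence renaming (refl to R-refl; sym to R-sym; trans to R-trans)

    malcev-compatible : Compatible₃ R malcev
    malcev-compatible x≈ y≈ z≈ = ∧-cong (*-cong (*-cong x≈ y≈) z≈) (*-cong (*-cong z≈ y≈) x≈)

    majority-compatible : Compatible₃ R majority
    majority-compatible x≈ y≈ z≈ = ∨-cong (∧-cong x≈ y≈) (∨-cong (∧-cong y≈ z≈) (∧-cong z≈ x≈))

    ≡⇒R : ∀ {x y} → x ≡ y → R x y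
    ≡⇒R refl = R-refl

    R⇒R*𝟏 : ∀ {x y} → R x y → R (x * y) 𝟏
    R⇒R*𝟏 {y = y} xRy = R-trans (*-cong xRy R-refl) (≡⇒R (*-refl y))

    R*𝟏⇒R∨ : ∀ {x y} → R (x * y) 𝟏 → R y (x ∨ y)
    R*𝟏⇒R∨ {x} {y} x*yR𝟏 =
      R-trans (≡⇒R (sym (L4 x y)))
              (R-trans (∧-cong R-refl x*yR𝟏) (≡⇒R (∧-identityʳ (x ∨ y))))

    R*𝟏⇒R : ∀ {x y} → R (x * y) 𝟏 → R (y * x) 𝟏 → R x y
    R*𝟏⇒R {x} {y} x*yR𝟏 y*xR𝟏 =
      R-trans (R*𝟏⇒R∨ y*xR𝟏) (R-trans (≡⇒R (∨-comm y x)) (R-sym (R*𝟏⇒R∨ x*yR𝟏)))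

  𝟏-class⊆⇒⊆ : ∀ {ℓ} (Θ Φ : Congruence L ℓ) →
               (∀ x → Congruence.R Θ x 𝟏 → Congruence.R Φ x 𝟏) →
               Congruence.R Θ ⊆ᵣ Congruence.R Φ
  𝟏-class⊆⇒⊆ Θ Φ [𝟏]Θ⊆[𝟏]Φ {x} {y} xΘy =
    R*𝟏⇒R Φ ([𝟏]Θ⊆[𝟏]Φ (x * y) (R⇒R*𝟏 Θ xΘy)) ([𝟏]Θ⊆[𝟏]Φ (y * x) (R⇒R*𝟏 Θ yΘx))
    where
      yΘx : Congruence.R Θ y x
      yΘx = IsEquivalence.sym (Congruence.isEquivalence Θ) xΘy

module _ {a ℓ : Level} (L : LSHA a) where
  open Properties L
  open Congruence

  private
    refl′ : (Θ : Congruence L ℓ) → Reflexive (R Θ)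
    refl′ Θ = IsEquivalence.refl (isEquivalence Θ)

    trans′ : (Θ : Congruence L ℓ) → Transitive (R Θ)
    trans′ Θ = IsEquivalence.trans (isEquivalence Θ)

  permutes : (Θ Φ : Congruence L ℓ) → (R Θ ∘ᵣ R Φ) ⊆ᵣ (R Φ ∘ᵣ R Θ)
  permutes Θ Φ =
    malcev⇒∘ᵣ-comm (R Θ) (R Φ) malcev malcev-xxz malcev-xzz
      (refl′ Θ) (refl′ Φ) (IsEquivalence.sym (isEquivalence Φ))
      (malcev-compatible Θ) (malcev-compatible Φ)

  distributes : (Θ Φ Ψ : Congruence L ℓ) → Distrib Θ Φ Ψ
  distributes Θ Φ Ψ = ∩-join⊆join-∩ , JoinRel-∩ᵣ (R Θ) (R Φ) (R Ψ) (trans′ Θ)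
    where
      join⊆∘ : JoinRel (R Φ) (R Ψ) ⊆ᵣ (R Φ ∘ᵣ R Ψ)
      join⊆∘ = ∘ᵣ-comm⇒JoinRel⊆∘ᵣ (R Φ) (R Ψ) (refl′ Φ) (refl′ Ψ) (trans′ Φ) (trans′ Ψ)
                 (permutes Ψ Φ)

      ∩-∘⊆∘-∩ : (R Θ ∩ᵣ (R Φ ∘ᵣ R Ψ)) ⊆ᵣ ((R Θ ∩ᵣ R Φ) ∘ᵣ (R Θ ∩ᵣ R Ψ))
      ∩-∘⊆∘-∩ =
        majority⇒∩-∘ᵣ-distrib (R Θ) (R Φ) (R Ψ)
          majority majority-xxy majority-xyx majority-yxx
          (refl′ Θ) (refl′ Φ) (refl′ Ψ)
          (majority-compatible Θ) (majority-compatible Φ) (majority-compatible Ψ)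

      ∩-join⊆join-∩ : (R Θ ∩ᵣ JoinRel (R Φ) (R Ψ)) ⊆ᵣ JoinRel (R Θ ∩ᵣ R Φ) (R Θ ∩ᵣ R Ψ)
      ∩-join⊆join-∩ (xΘy , xJy) =
        ∘ᵣ⊆JoinRel (R Θ ∩ᵣ R Φ) (R Θ ∩ᵣ R Ψ) (∩-∘⊆∘-∩ (xΘy , join⊆∘ xJy))

weaklyRegular : WeaklyRegular
weaklyRegular L Θ Φ [𝟏]Θ≐[𝟏]Φ =
  𝟏-class⊆⇒⊆ Θ Φ (proj₁ ∘ [𝟏]Θ≐[𝟏]Φ) , 𝟏-class⊆⇒⊆ Φ Θ (proj₂ ∘ [𝟏]Θ≐[𝟏]Φ)
  where open Properties L

mainTheorem7 : ArithmeticalAndWeaklyRegular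
mainTheorem7 = record
  { arithmetical = record
    { permutable   = λ L Θ Φ → permutes L Θ Φ , permutes L Φ Θ
    ; distributive = distributes
    }
  ; weaklyRegular = weaklyRegular
  }
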